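{- For integers $n>1$ and positive integers $a\neq b$, $\chi_{ld}(K_{a,b}[\overline{K_n}])=2$.
   Context: For a graph $G=(V,E)$ of order $N$ and a bijection $f\colon V\to\{1,\dots,N\}$, the weight of a vertex $u$ is $w(u)=\sum_{x\in N(u)}f(x)$, where $N(u)$ is the open neighborhood of $u$. The bijection $f$ is a local distance antimagic labeling if $w(u)\neq w(v)$ for every edge $uv$. $\chi_{ld}(G)$ is the minimum number of distinct weights over all local distance antimagic labelings of $G$. $K_{a,b}$ is the complete bipartite graph with parts of sizes $a$ and $b$; $\overline{K_n}$ is the edgeless graph on $n$ vertices. The lexicographic product $G[H]$ has vertex set $V(G)\times V(H)$, with $(g,h)$ adjacent to $(g',h')$ iff $gg'\in E(G)$, or $g=g'$ and $hh'\in E(H)$. -}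

module Defs where

open import Data.Nat using (ℕ; suc; _+_; _*_; _≤_)
open import Data.Nat.Properties using (_≟_)
open import Data.Bool using (Bool; true; false; _∨_; _∧_; _xor_; if_then_else_)
open import Data.Fin using (Fin; toℕ; splitAt; remQuot)
import Data.Fin as F
open import Data.Sum using (isInj₁)
open import Data.Maybe using (is-just)
open import Data.Product using (_×_; _,_; Σ)
open import Data.List using (List; length; map; deduplicate)
open import Data.Nat.ListAction using (sum)
open import Data.List.Base using (allFin)
open import Function.Definitions using (Bijective)
open import Relation.Binary.PropositionalEquality using (_≡_; _≢_)
open import Relation.Nullary.Decidable using (⌊_⌋)

record Graph : Set where
  field
    order : ℕ
    Adj   : Fin order → Fin order → Bool
open Graph public

Edge : (G : Graph) → Fin (order G) → Fin (order G) → Set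
Edge G u v = Adj G u v ≡ true

-- Complete bipartite graph K_{a,b}: vertices 0..a-1 form one part, a..a+b-1 the other.
K : ℕ → ℕ → Graph
K a b = record
  { order = a + b
  ; Adj   = λ u v → is-just (isInj₁ (splitAt a u)) xor is-just (isInj₁ (splitAt a v)) }

Kbar : ℕ → Graph
Kbar n = record { order = n ; Adj = λ _ _ → false }

-- Lexicographic product G[H]; the vertex i of Fin (|G| * |H|) is the pair remQuot i.
lex : Graph → Graph → Graph
lex G H = record
  { order = order G * order H
  ; Adj   = λ u v → adj (remQuot (order H) u) (remQuot (order H) v) }
  where
  adj : Fin (order G) × Fin (order H) → Fin (order G) × Fin (order H) → Bool
  adj (g , h) (g′ , h′) = Adj G g g′ ∨ (⌊ g F.≟ g′ ⌋ ∧ Adj H h h′)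

-- A labeling is a bijection f : V → Fin N, vertex u receiving label toℕ (f u) + 1 ∈ {1..N}.
Labeling : Graph → Set
Labeling G = Σ (Fin (order G) → Fin (order G)) (Bijective _≡_ _≡_)

label : (G : Graph) → (Fin (order G) → Fin (order G)) → Fin (order G) → ℕ
label G f x = suc (toℕ (f x))

weight : (G : Graph) → (Fin (order G) → Fin (order G)) → Fin (order G) → ℕ
weight G f u = sum (map (λ x → if Adj G u x then label G f x else 0) (allFin (order G)))

IsLDAntimagic : (G : Graph) → (Fin (order G) → Fin (order G)) → Set
IsLDAntimagic G f = ∀ u v → Edge G u v → weight G f u ≢ weight G f v

numWeights : (G : Graph) → (Fin (order G) → Fin (order G)) → ℕ
numWeights G f = length (deduplicate _≟_ (map (weight G f) (allFin (order G))))

ChiLD≡ : Graph → ℕ → Set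
ChiLD≡ G k =
  (Σ (Labeling G) λ (f , _) → IsLDAntimagic G f × numWeights G f ≡ k)
  × (∀ ((f , _) : Labeling G) → IsLDAntimagic G f → k ≤ numWeights G f)

-- The lexicographic product K_{a,b}[K̄_n] is itself the complete bipartite graph K_{an,bn}, so
-- every vertex of one part has as weight the label sum of the other part: a labeling has at most
-- two weights, and it is local distance antimagic exactly when the two part sums differ. If the
-- identity labeling has equal part sums, exchanging the labels of one vertex from each part moves
-- the two sums by opposite nonzero amounts.
module Submission where

open import Defs
open import Data.Nat using (ℕ; zero; suc; _+_; _≤_; _<_; z≤n; s≤s)
open import Algebra.Properties.CommutativeSemigroup using (xy∙z≈zy∙x)
open import Data.Bool using (Bool; true; false; _∨_; _xor_; if_then_else_)
open import Data.Bool.Properties using (∧-zeroʳ; ∨-identityʳ)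
open import Data.Empty using (⊥-elim)
open import Data.Fin using (Fin; zero; suc; toℕ; splitAt; remQuot; combine; _↑ʳ_)
open import Data.Fin.Permutation using (transpose)
import Data.Fin.Permutation.Components as Components
open import Data.Fin.Properties using (remQuot-combine; splitAt-↑ʳ; toℕ-injective)
import Data.Fin.Properties as Fin
open import Data.List using (List; []; _∷_; length; map; deduplicate; tabulate; allFin)
open import Data.List.Membership.Propositional using (_∈_)
open import Data.List.Membership.Propositional.Properties using (∈-deduplicate⁺; ∈-map⁺; ∈-allFin)
open import Data.List.Properties using (map-cong; map-tabulate; tabulate-cong)
open import Data.List.Relation.Unary.All using (All; _∷_; universal)
open import Data.List.Relation.Unary.All.Properties using (deduplicate⁺; map⁺)
open import Data.List.Relation.Unary.AllPairs using (_∷_)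
open import Data.List.Relation.Unary.Any using (here)
open import Data.List.Relation.Unary.Unique.Propositional using (Unique)
open import Data.List.Relation.Unary.Unique.DecPropositional.Properties using (deduplicate-!)
open import Data.Maybe using (is-just)
open import Data.Nat.ListAction using (sum)
open import Data.Nat.Properties using (_≟_; ≤-antisym; +-assoc; +-commutativeSemigroup; m≢1+n+m; suc-injective)
open import Data.Product using (Σ; _,_; proj₁)
open import Data.Sum using (_⊎_; inj₁; inj₂; [_,_]; isInj₁)
open import Function using (id; _∘_)
open import Function.Bundles using (Bijection)
open import Function.Properties.Inverse using (Inverse⇒Bijection)
import Function.Construct.Identity as Identity
open import Relation.Binary.PropositionalEquality using (_≡_; _≢_; refl; sym; trans; cong; cong₂; module ≡-Reasoning)
open import Relation.Nullary using (yes; no)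
open import Relation.Nullary.Decidable using (dec-true; dec-false)

private
  variable
    A : Set

distinct-∈⇒2≤length : ∀ {xs : List A} {x y} → x ≢ y → x ∈ xs → y ∈ xs → 2 ≤ length xs
distinct-∈⇒2≤length {xs = _ ∷ _ ∷ _} _   _          _          = s≤s (s≤s z≤n)
distinct-∈⇒2≤length {xs = _ ∷ []}    x≢y (here refl) (here refl) = ⊥-elim (x≢y refl)

distinct-∈⇒2≤length-deduplicate : ∀ {xs : List ℕ} {x y} → x ≢ y → x ∈ xs → y ∈ xs →
                                  2 ≤ length (deduplicate _≟_ xs)
distinct-∈⇒2≤length-deduplicate x≢y x∈ y∈ =
  distinct-∈⇒2≤length x≢y (∈-deduplicate⁺ _≟_ x∈) (∈-deduplicate⁺ _≟_ y∈)

InPair : A → A → A → Set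
InPair p q x = x ≡ p ⊎ x ≡ q

pigeonhole-InPair : ∀ {p q x y z : A} → InPair p q x → InPair p q y → InPair p q z →
                    x ≡ y ⊎ x ≡ z ⊎ y ≡ z
pigeonhole-InPair (inj₁ refl) (inj₁ refl) _           = inj₁ refl
pigeonhole-InPair (inj₂ refl) (inj₂ refl) _           = inj₁ refl
pigeonhole-InPair (inj₁ refl) (inj₂ refl) (inj₁ refl) = inj₂ (inj₁ refl)
pigeonhole-InPair (inj₁ refl) (inj₂ refl) (inj₂ refl) = inj₂ (inj₂ refl)
pigeonhole-InPair (inj₂ refl) (inj₁ refl) (inj₁ refl) = inj₂ (inj₂ refl)
pigeonhole-InPair (inj₂ refl) (inj₁ refl) (inj₂ refl) = inj₂ (inj₁ refl)

unique-InPair⇒length≤2 : ∀ {p q : A} {ys} → Unique ys → All (InPair p q) ys → length ys ≤ 2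
unique-InPair⇒length≤2 {ys = []}          _ _ = z≤n
unique-InPair⇒length≤2 {ys = _ ∷ []}      _ _ = s≤s z≤n
unique-InPair⇒length≤2 {ys = _ ∷ _ ∷ []}  _ _ = s≤s (s≤s z≤n)
unique-InPair⇒length≤2 {ys = _ ∷ _ ∷ _ ∷ _}
  ((x≢y ∷ x≢z ∷ _) ∷ (y≢z ∷ _) ∷ _) (x∈ ∷ y∈ ∷ z∈ ∷ _) =
  ⊥-elim ([ x≢y , [ x≢z , y≢z ] ] (pigeonhole-InPair x∈ y∈ z∈))

length-deduplicate≤2 : ∀ {p q} {xs : List ℕ} → All (InPair p q) xs → length (deduplicate _≟_ xs) ≤ 2
length-deduplicate≤2 {xs = xs} all =
  unique-InPair⇒length≤2 (deduplicate-! _≟_ xs) (deduplicate⁺ _≟_ all)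

m+x≡n+y⇒m+y≡n+x⇒x≡y : ∀ m n {x y} → m + x ≡ n + y → m + y ≡ n + x → x ≡ y
m+x≡n+y⇒m+y≡n+x⇒x≡y zero    zero    e _ = e
m+x≡n+y⇒m+y≡n+x⇒x≡y (suc m) (suc n) e e′ =
  m+x≡n+y⇒m+y≡n+x⇒x≡y m n (suc-injective e) (suc-injective e′)
m+x≡n+y⇒m+y≡n+x⇒x≡y zero    (suc n) {x} e e′ =
  ⊥-elim (m≢1+n+m x (trans e (cong suc (trans (cong (n +_) e′) (sym (+-assoc n (suc n) x))))))
m+x≡n+y⇒m+y≡n+x⇒x≡y (suc m) zero    e e′ = sym (m+x≡n+y⇒m+y≡n+x⇒x≡y zero (suc m) (sym e) (sym e′))

∑ : ∀ {m} → (Fin m → ℕ) → ℕ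
∑ {m} f = sum (map f (allFin m))

sum-tabulate-agreeExcept : ∀ {m} (f g : Fin m → ℕ) (u : Fin m) → (∀ x → x ≢ u → f x ≡ g x) →
                           sum (tabulate f) + g u ≡ sum (tabulate g) + f u
sum-tabulate-agreeExcept f g zero agree = begin
  f zero + sum (tabulate (f ∘ suc)) + g zero
    ≡⟨ cong (λ t → f zero + t + g zero) (cong sum (tabulate-cong (λ x → agree (suc x) λ ()))) ⟩
  f zero + sum (tabulate (g ∘ suc)) + g zero
    ≡⟨ xy∙z≈zy∙x +-commutativeSemigroup (f zero) _ (g zero) ⟩
  g zero + sum (tabulate (g ∘ suc)) + f zero ∎
  where open ≡-Reasoning
sum-tabulate-agreeExcept f g (suc u) agree = begin
  f zero + sum (tabulate (f ∘ suc)) + g (suc u)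
    ≡⟨ +-assoc (f zero) _ _ ⟩
  f zero + (sum (tabulate (f ∘ suc)) + g (suc u))
    ≡⟨ cong₂ _+_ (agree zero λ ())
                 (sum-tabulate-agreeExcept (f ∘ suc) (g ∘ suc) u
                   λ x x≢u → agree (suc x) (x≢u ∘ Fin.suc-injective)) ⟩
  g zero + (sum (tabulate (g ∘ suc)) + f (suc u))
    ≡⟨ +-assoc (g zero) _ _ ⟨
  g zero + sum (tabulate (g ∘ suc)) + f (suc u) ∎
  where open ≡-Reasoning

∑-agreeExcept : ∀ {m} (f g : Fin m → ℕ) (u : Fin m) → (∀ x → x ≢ u → f x ≡ g x) → ∑ f + g u ≡ ∑ g + f u
∑-agreeExcept f g u agree = begin
  ∑ f + g u               ≡⟨ cong (λ t → sum t + g u) (map-tabulate id f) ⟩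
  sum (tabulate f) + g u  ≡⟨ sum-tabulate-agreeExcept f g u agree ⟩
  sum (tabulate g) + f u  ≡⟨ cong (λ t → sum t + f u) (map-tabulate id g) ⟨
  ∑ g + f u ∎
  where open ≡-Reasoning

transpose-matchˡ : ∀ {n} (i j : Fin n) → Components.transpose i j i ≡ j
transpose-matchˡ i j rewrite dec-true (i Fin.≟ i) refl = refl

transpose-matchʳ : ∀ {n} {i j : Fin n} → j ≢ i → Components.transpose i j j ≡ i
transpose-matchʳ {i = i} {j} j≢i rewrite dec-false (j Fin.≟ i) j≢i | dec-true (j Fin.≟ j) refl = refl

transpose-other : ∀ {n} {i j k : Fin n} → k ≢ i → k ≢ j → Components.transpose i j k ≡ k
transpose-other {i = i} {j} {k} k≢i k≢j
  rewrite dec-false (k Fin.≟ i) k≢i | dec-false (k Fin.≟ j) k≢j = refl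

antimagic⇒2≤numWeights : ∀ G {f u v} → IsLDAntimagic G f → Edge G u v → 2 ≤ numWeights G f
antimagic⇒2≤numWeights G {f} {u} {v} antimagic uv =
  distinct-∈⇒2≤length-deduplicate (antimagic u v uv) (∈-map⁺ (weight G f) (∈-allFin u))
                                                     (∈-map⁺ (weight G f) (∈-allFin v))

module CompleteBipartite (G : Graph) (side : Fin (order G) → Bool)
                         (Adj≡xor : ∀ u v → Adj G u v ≡ side u xor side v) where

  private
    V : Set
    V = Fin (order G)

  oppositeLabel : (V → V) → Bool → V → ℕ
  oppositeLabel f s x = if s xor side x then label G f x else 0

  oppositeLabel-sameSide : ∀ f {s x} → s xor side x ≡ false → oppositeLabel f s x ≡ 0
  oppositeLabel-sameSide f {x = x} same = cong (if_then label G f x else 0) same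

  oppositeSum : (V → V) → Bool → ℕ
  oppositeSum f s = ∑ (oppositeLabel f s)

  weight≡oppositeSum : ∀ f u → weight G f u ≡ oppositeSum f (side u)
  weight≡oppositeSum f u =
    cong sum (map-cong (λ x → cong (if_then label G f x else 0) (Adj≡xor u x)) (allFin (order G)))

  weight-InPair : ∀ f u → InPair (oppositeSum f true) (oppositeSum f false) (weight G f u)
  weight-InPair f u with side u | weight≡oppositeSum f u
  ... | true  | w = inj₁ w
  ... | false | w = inj₂ w

  numWeights≤2 : ∀ f → numWeights G f ≤ 2
  numWeights≤2 f = length-deduplicate≤2 (map⁺ (universal (weight-InPair f) (allFin (order G))))

  oppositeSum-distinct⇒antimagic : ∀ f → oppositeSum f true ≢ oppositeSum f false → IsLDAntimagic G f
  oppositeSum-distinct⇒antimagic f O≢ u v uv wu≡wv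
    with side u | side v | trans (sym (Adj≡xor u v)) uv | weight≡oppositeSum f u | weight≡oppositeSum f v
  ... | true  | false | _ | wu | wv = O≢ (trans (sym wu) (trans wu≡wv wv))
  ... | false | true  | _ | wu | wv = O≢ (trans (sym wv) (trans (sym wu≡wv) wu))

  module _ {u v : V} (side-u : side u ≡ true) (side-v : side v ≡ false) where

    u≢v : u ≢ v
    u≢v u≡v with trans (sym side-u) (trans (cong side u≡v) side-v)
    ... | ()

    σ : V → V
    σ = Components.transpose u v

    σ-fixes : ∀ s {x} → x ≢ u → x ≢ v → oppositeLabel σ s x ≡ oppositeLabel id s x
    σ-fixes s {x} x≢u x≢v = cong (λ y → if s xor side x then suc (toℕ y) else 0) (transpose-other x≢u x≢v)

    oppositeSum-swap-false : oppositeSum σ false + suc (toℕ u) ≡ oppositeSum id false + suc (toℕ v)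
    oppositeSum-swap-false = begin
      oppositeSum σ false + suc (toℕ u)
        ≡⟨ cong (λ b → oppositeSum σ false + (if b then suc (toℕ u) else 0)) side-u ⟨
      oppositeSum σ false + oppositeLabel id false u
        ≡⟨ ∑-agreeExcept (oppositeLabel σ false) (oppositeLabel id false) u agree ⟩
      oppositeSum id false + oppositeLabel σ false u
        ≡⟨ cong₂ (λ b y → oppositeSum id false + (if b then suc (toℕ y) else 0)) side-u
                 (transpose-matchˡ u v) ⟩
      oppositeSum id false + suc (toℕ v) ∎
      where
      open ≡-Reasoning
      agree : ∀ x → x ≢ u → oppositeLabel σ false x ≡ oppositeLabel id false x
      -- v ≟ x rather than x ≟ v: the latter occurs inside σ x and would be abstracted by the with.
      agree x x≢u with v Fin.≟ x
      ... | yes v≡x =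
        trans (oppositeLabel-sameSide σ {false} same) (sym (oppositeLabel-sameSide id {false} same))
        where
        same : false xor side x ≡ false
        same = trans (cong side (sym v≡x)) side-v
      ... | no v≢x = σ-fixes false x≢u (v≢x ∘ sym)

    oppositeSum-swap-true : oppositeSum σ true + suc (toℕ v) ≡ oppositeSum id true + suc (toℕ u)
    oppositeSum-swap-true = begin
      oppositeSum σ true + suc (toℕ v)
        ≡⟨ cong (λ b → oppositeSum σ true + (if true xor b then suc (toℕ v) else 0)) side-v ⟨
      oppositeSum σ true + oppositeLabel id true v
        ≡⟨ ∑-agreeExcept (oppositeLabel σ true) (oppositeLabel id true) v agree ⟩
      oppositeSum id true + oppositeLabel σ true v
        ≡⟨ cong₂ (λ b y → oppositeSum id true + (if true xor b then suc (toℕ y) else 0)) side-v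
                 (transpose-matchʳ (u≢v ∘ sym)) ⟩
      oppositeSum id true + suc (toℕ u) ∎
      where
      open ≡-Reasoning
      agree : ∀ x → x ≢ v → oppositeLabel σ true x ≡ oppositeLabel id true x
      agree x x≢v with u Fin.≟ x
      ... | yes u≡x = trans (oppositeLabel-sameSide σ same) (sym (oppositeLabel-sameSide id same))
        where
        same : true xor side x ≡ false
        same = cong (true xor_) (trans (cong side (sym u≡x)) side-u)
      ... | no u≢x = σ-fixes true (u≢x ∘ sym) x≢v

    separatingLabeling : Σ (Labeling G) λ (f , _) → oppositeSum f true ≢ oppositeSum f false
    separatingLabeling with oppositeSum id true ≟ oppositeSum id false
    ... | no  id-separates = (id , Identity.bijective _≡_) , id-separates
    ... | yes id-balanced  = (σ , Bijection.bijective (Inverse⇒Bijection (transpose u v))) , σ-separates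
      where
      σ-separates : oppositeSum σ true ≢ oppositeSum σ false
      σ-separates σ-balanced = u≢v (toℕ-injective (suc-injective
        (m+x≡n+y⇒m+y≡n+x⇒x≡y (oppositeSum σ false) (oppositeSum id false) oppositeSum-swap-false (begin
          oppositeSum σ false + suc (toℕ v) ≡⟨ cong (_+ suc (toℕ v)) σ-balanced ⟨
          oppositeSum σ true + suc (toℕ v)  ≡⟨ oppositeSum-swap-true ⟩
          oppositeSum id true + suc (toℕ u) ≡⟨ cong (_+ suc (toℕ u)) id-balanced ⟩
          oppositeSum id false + suc (toℕ u) ∎))))
        where open ≡-Reasoning

    χld≡2 : ChiLD≡ G 2
    χld≡2 with separatingLabeling
    ... | labeling@(f , _) , separates =
      (labeling , antimagic , ≤-antisym (numWeights≤2 f) (antimagic⇒2≤numWeights G antimagic uv))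
      , λ _ antimagic′ → antimagic⇒2≤numWeights G antimagic′ uv
      where
      uv : Edge G u v
      uv = trans (Adj≡xor u v) (cong₂ _xor_ side-u side-v)
      antimagic : IsLDAntimagic G f
      antimagic = oppositeSum-distinct⇒antimagic f separates

Adj-lex-Kbar : ∀ G n u v → Adj (lex G (Kbar n)) u v ≡ Adj G (proj₁ (remQuot n u)) (proj₁ (remQuot n v))
Adj-lex-Kbar G n u v = trans (cong (Adj G _ _ ∨_) (∧-zeroʳ _)) (∨-identityʳ _)

inFirstPart : ∀ a {b} → Fin (a + b) → Bool
inFirstPart a g = is-just (isInj₁ (splitAt a g))

χld-K[Kbar]≡2 : ∀ a b n → ChiLD≡ (lex (K (suc a) (suc b)) (Kbar (suc n))) 2
χld-K[Kbar]≡2 a b n =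
  CompleteBipartite.χld≡2 G side (Adj-lex-Kbar (K (suc a) (suc b)) (suc n)) {u} {v} side-u side-v
  where
  G : Graph
  G = lex (K (suc a) (suc b)) (Kbar (suc n))

  side : Fin (order G) → Bool
  side x = inFirstPart (suc a) (proj₁ (remQuot (suc n) x))

  u v : Fin (order G)
  u = combine {suc a + suc b} {suc n} zero zero
  v = combine {suc a + suc b} {suc n} (suc a ↑ʳ zero) zero

  side-u : side u ≡ true
  side-u = cong (inFirstPart (suc a) ∘ proj₁) (remQuot-combine {suc a + suc b} {suc n} zero zero)

  side-v : side v ≡ false
  side-v = trans (cong (inFirstPart (suc a) ∘ proj₁)
                       (remQuot-combine {suc a + suc b} {suc n} (suc a ↑ʳ zero) zero))
                 (cong (is-just ∘ isInj₁) (splitAt-↑ʳ (suc a) (suc b) zero))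

mainTheorem9 : (n a b : ℕ) → 1 < n → 0 < a → 0 < b → a ≢ b → ChiLD≡ (lex (K a b) (Kbar n)) 2
mainTheorem9 (suc n) (suc a) (suc b) _ _ _ _ = χld-K[Kbar]≡2 a b n
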